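{- Let $n,m,k$ be nonnegative integers and let $\lambda$ be a partition of $n$ into distinct parts with first (largest) part $\lambda_1=k$ and with $\lambda_1+\lambda_3+\lambda_5+\cdots=m$. Let $\mu$ be the partition into odd parts with $\mathrm{B}(\mu)=\lambda$, where $\mathrm{B}$ is Bessenrodt's bijection described in the context. Then $\mu$ has exactly $2m-n$ parts and its first part is $\mu_1=1+2k+2n-4m$.
   Context: A partition is a weakly decreasing sequence of nonnegative integers $\lambda=(\lambda_1,\lambda_2,\dots)$ that is eventually zero; its parts are the nonzero terms and its size is $|\lambda|=\sum_i\lambda_i$; $\lambda_i=0$ for $i$ beyond the number of parts. Bessenrodt's bijection $\mathrm{B}$ is the following size-preserving bijection from partitions with all parts odd to partitions with distinct parts. For $\mu$ with odd parts, write $\mu_i=2\nu_i-1$; the 2-modular diagram of $\mu$ is the Young diagram of the partition $\nu=(\nu_1,\nu_2,\dots)$ (row $i$ has $\nu_i$ cells, rows left-aligned, cell $(i,j)$ is in row $i$ and column $j$), in which the last cell of each row is filled with $1$ and all other cells with $2$. For each $i$ with $(i,i)$ a cell of this diagram, the $i$-th diagonal hook consists of the cell $(i,i)$ together with all cells of the diagram directly to its right in row $i$ and directly below it in column $i$. Then $\mathrm{B}(\mu)_{2i-1}$ is the total number of cells (entries $2$ and $1$) in the $i$-th diagonal hook, and $\mathrm{B}(\mu)_{2i}$ is the number of cells filled with $2$ in the $i$-th diagonal hook (zero values are discarded). -}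

module Defs where

open import Data.Nat using (ℕ; zero; suc; _+_; _*_; _∸_; _≤_; _<_; _>_; _≥_; ⌊_/2⌋; _≟_; _≤?_; _<?_)
open import Data.List using (List; []; _∷_; _++_; length; map; filter; concatMap; upTo)
open import Data.Nat.ListAction using (sum)
open import Relation.Nullary using (yes; no)
open import Data.List.Relation.Unary.All using (All)
open import Data.List.Relation.Unary.Linked using (Linked)
open import Data.Product using (∃; _×_; _,_)
open import Relation.Binary.PropositionalEquality using (_≡_)

IsPartition : List ℕ → Set
IsPartition xs = Linked _≥_ xs × All (λ x → 0 < x) xs

IsDistinctPartition : List ℕ → Set
IsDistinctPartition xs = Linked _>_ xs × All (λ x → 0 < x) xs

Odd : ℕ → Set
Odd x = ∃ λ j → x ≡ suc (2 * j)

IsOddPartition : List ℕ → Set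
IsOddPartition xs = IsPartition xs × All Odd xs

size : List ℕ → ℕ
size = sum

-- λ_i (1-indexed), zero beyond the number of parts (and λ_0 := 0, unused).
part : List ℕ → ℕ → ℕ
part []       _             = 0
part (x ∷ xs) zero          = 0
part (x ∷ xs) (suc zero)    = x
part (x ∷ xs) (suc (suc i)) = part xs (suc i)

oddIndexedSum : List ℕ → ℕ
oddIndexedSum []           = 0
oddIndexedSum (x ∷ [])     = x
oddIndexedSum (x ∷ _ ∷ xs) = x + oddIndexedSum xs

range : ℕ → ℕ → List ℕ
range a b = map (a +_) (upTo (suc b ∸ a))

-- ν with μ_i = 2 ν_i − 1
toNu : List ℕ → List ℕ
toNu = map (λ x → ⌊ suc x /2⌋)

-- Cells of the i-th diagonal hook of the 2-modular diagram of μ (cells (row, column)):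
-- (i,j) for i ≤ j ≤ ν_i, and (r,i) for i < r ≤ ℓ(ν) with (r,i) a cell, i.e. i ≤ ν_r.
hookCells : List ℕ → ℕ → List (ℕ × ℕ)
hookCells μ i =
  map (λ j → (i , j)) (range i (part ν i))
  ++ map (λ r → (r , i)) (filter (λ r → i ≤? part ν r) (range (suc i) (length ν)))
  where ν = toNu μ

-- Filling of cell (i,j) of the 2-modular diagram: 1 in the last cell of a row, 2 otherwise.
fill : List ℕ → ℕ × ℕ → ℕ
fill μ (i , j) with j ≟ part (toNu μ) i
... | yes _ = 1
... | no  _ = 2

diagonal : List ℕ → List ℕ
diagonal μ = filter (λ i → i ≤? part (toNu μ) i) (range 1 (length (toNu μ)))

hookSize : List ℕ → ℕ → ℕ
hookSize μ i = length (hookCells μ i)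

hookTwos : List ℕ → ℕ → ℕ
hookTwos μ i = length (filter (λ c → fill μ c ≟ 2) (hookCells μ i))

B : List ℕ → List ℕ
B μ = filter (λ x → 0 <? x) (concatMap (λ i → hookSize μ i ∷ hookTwos μ i ∷ []) (diagonal μ))

-- Write μᵢ = 2νᵢ − 1. Deleting the first row and the first column of the 2-modular diagram of μ
-- leaves the diagram of ν* = (ν₂ − 1, ν₃ − 1, …), and the i-th diagonal hook of the smaller
-- diagram is the (i+1)-th one of the larger, with the same fillings. The first diagonal hook has
-- ν₁ + ℓ(μ) − 1 cells, of which ν₁ − 1 + #{i ≥ 2 : νᵢ ≥ 2} are filled with 2. Peeling off the
-- hooks one at a time therefore gives λ₁ + λ₃ + ⋯ = |ν| and |λ| + ℓ(μ) = 2|ν| = |μ| + ℓ(μ), and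
-- the first hook gives 2λ₁ + 1 = μ₁ + 2ℓ(μ). Solving for ℓ(μ) and μ₁ yields the theorem.

module Submission where

open import Defs
open import Data.Bool using (true; false; not; _∧_)
open import Data.Bool.Properties using (∧-zeroʳ)
import Data.Integer as ℤ
import Data.Integer.Properties as ℤ
open import Data.List using (List; []; _∷_; _++_; length; map; filter; concat; concatMap; upTo; applyUpTo)
open import Data.List.Properties
  using (map-∘; map-cong; map-cong-local; map-++; length-map; length-++; length-upTo; map-upTo; map-applyUpTo;
         concatMap-map; concatMap-cong; ++-identityʳ; upTo-∷ʳ; filter-all; filter-++; filter-none; filter-reject)
open import Data.List.Relation.Unary.All as All using (All; []; _∷_)
import Data.List.Relation.Unary.All.Properties as All
open import Data.List.Relation.Unary.Linked as Linked using (Linked; []; [-]; _∷_)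
import Data.List.Relation.Unary.Linked.Properties as Linked
open import Data.Nat
  using (ℕ; zero; suc; pred; _+_; _*_; _∸_; _≤_; _≥_; z≤n; s≤s; _≟_; _≤?_; _<?_; ⌊_/2⌋)
open import Data.Nat.ListAction using (sum)
open import Data.Nat.Properties
  using (+-identityʳ; +-suc; +-comm; +-assoc; *-assoc; *-distribˡ-+; +-cancelʳ-≡; +-∸-assoc; m+n∸m≡n;
         m+n∸n≡m; m≤m+n; m≤n+m; 0∸n≡0; m+n≡0⇒n≡0; <⇒≢; suc-injective; pred-mono-≤; n≡⌊n+n/2⌋; ⌊n/2⌋-mono)
open import Data.Nat.Tactic.RingSolver using (solve-∀)
open import Data.Product using (_×_; _,_; ∃; proj₂)
import Data.Product as Product
open import Function using (_∘_; id)
open import Relation.Binary.PropositionalEquality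
  using (_≡_; _≢_; refl; sym; trans; cong; cong₂; subst; module ≡-Reasoning)
open import Relation.Nullary using (¬_; does; yes; no; ¬?)
open import Relation.Nullary.Decidable using (dec-true; dec-false)
open import Relation.Unary using (Pred; Decidable)
open import Relation.Unary.Properties using (_∩?_)

private
  variable
    A A′ : Set

module _ {p} {P : Pred A p} (P? : Decidable P) where

  filter-map : ∀ (f : A′ → A) xs → filter P? (map f xs) ≡ map f (filter (P? ∘ f) xs)
  filter-map f [] = refl
  filter-map f (x ∷ xs) with does (P? (f x))
  ... | true  = cong (f x ∷_) (filter-map f xs)
  ... | false = filter-map f xs

  length-filter-map : ∀ (f : A′ → A) xs → length (filter P? (map f xs)) ≡ length (filter (P? ∘ f) xs)
  length-filter-map f xs = trans (cong length (filter-map f xs)) (length-map f (filter (P? ∘ f) xs))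

module _ {p q} {P : Pred A p} {Q : Pred A q} (P? : Decidable P) (Q? : Decidable Q) where

  filter-cong-local : ∀ {xs} → All (λ x → does (P? x) ≡ does (Q? x)) xs → filter P? xs ≡ filter Q? xs
  filter-cong-local {[]}     []         = refl
  filter-cong-local {x ∷ xs} (eq ∷ eqs) with does (P? x) | does (Q? x) | eq
  ... | true  | true  | refl = cong (x ∷_) (filter-cong-local eqs)
  ... | false | false | refl = filter-cong-local eqs

  filter-filter : ∀ xs → filter P? (filter Q? xs) ≡ filter (P? ∩? Q?) xs
  filter-filter [] = refl
  filter-filter (x ∷ xs) with does (Q? x)
  ... | false rewrite ∧-zeroʳ (does (P? x)) = filter-filter xs
  ... | true with does (P? x)
  ...   | true  = cong (x ∷_) (filter-filter xs)
  ...   | false = filter-filter xs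

range-suc : ∀ a b → range (suc a) (suc b) ≡ map suc (range a b)
range-suc a b = map-∘ (upTo (suc b ∸ a))

range-∷ : ∀ a k → range a (a + k) ≡ a ∷ range (suc a) (a + k)
range-∷ a k rewrite +-∸-assoc 1 (m≤m+n a k) | m+n∸m≡n a k =
  cong₂ _∷_ (+-identityʳ a) (begin
    map (a +_) (applyUpTo suc k)   ≡⟨ map-applyUpTo suc (a +_) k ⟩
    applyUpTo (λ u → a + suc u) k  ≡⟨ map-upTo (λ u → a + suc u) k ⟨
    map (λ u → a + suc u) (upTo k) ≡⟨ map-cong (+-suc a) (upTo k) ⟩
    map (suc a +_) (upTo k)        ∎)
  where open ≡-Reasoning

range-1-suc : ∀ b → range 1 (suc b) ≡ 1 ∷ map suc (range 1 b)
range-1-suc b = trans (range-∷ 1 b) (cong (1 ∷_) (range-suc 1 b))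

range-pred : ∀ a b → range (2 + a) b ≡ map suc (range (suc a) (pred b))
range-pred a zero rewrite 0∸n≡0 a = refl
range-pred a (suc b) = range-suc (suc a) b

All-range : ∀ {p} {P : Pred ℕ p} a b → (∀ u → P (a + u)) → All P (range a b)
All-range a b Pa+ = All.map⁺ (All.universal Pa+ (upTo (suc b ∸ a)))

part-map-pred : ∀ xs r → part (map pred xs) r ≡ pred (part xs r)
part-map-pred []       r             = refl
part-map-pred (x ∷ xs) zero          = refl
part-map-pred (x ∷ xs) (suc zero)    = refl
part-map-pred (x ∷ xs) (suc (suc r)) = part-map-pred xs (suc r)

map-part-range : ∀ xs → map (part xs) (range 1 (length xs)) ≡ xs
map-part-range-tail : ∀ y ys → map (part (y ∷ ys)) (range 2 (suc (length ys))) ≡ ys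

map-part-range []       = refl
map-part-range (y ∷ ys) = trans (cong (map (part (y ∷ ys))) (range-∷ 1 (length ys)))
                                (cong (y ∷_) (map-part-range-tail y ys))

map-part-range-tail y ys = begin
  map (part (y ∷ ys)) (range 2 (suc L))          ≡⟨ cong (map (part (y ∷ ys))) (range-suc 1 L) ⟩
  map (part (y ∷ ys)) (map suc (map suc (upTo L))) ≡⟨ map-∘ (map suc (upTo L)) ⟨
  map (part (y ∷ ys) ∘ suc) (map suc (upTo L))   ≡⟨ map-∘ (upTo L) ⟨
  map (part ys ∘ suc) (upTo L)                   ≡⟨ map-∘ (upTo L) ⟩
  map (part ys) (range 1 L)                      ≡⟨ map-part-range ys ⟩
  ys                                             ∎
  where
  open ≡-Reasoning
  L = length ys

length-filter-part-tail : ∀ {q} {Q : Pred ℕ q} (Q? : Decidable Q) y ys →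
  length (filter (Q? ∘ part (y ∷ ys)) (range 2 (suc (length ys)))) ≡ length (filter Q? ys)
length-filter-part-tail Q? y ys =
  trans (sym (length-filter-map Q? (part (y ∷ ys)) (range 2 (suc (length ys)))))
        (cong (length ∘ filter Q?) (map-part-range-tail y ys))

count≥ : ℕ → List ℕ → ℕ
count≥ t xs = length (filter (t ≤?_) xs)

does-≤?-pred : ∀ t y → does (2 + t ≤? y) ≡ does (suc t ≤? pred y)
does-≤?-pred t zero    = refl
does-≤?-pred t (suc y) = refl

count≥-pred : ∀ t xs → count≥ (suc t) (map pred xs) ≡ count≥ (2 + t) xs
count≥-pred t xs = trans (length-filter-map (suc t ≤?_) pred xs)
  (cong length (filter-cong-local ((suc t ≤?_) ∘ pred) (2 + t ≤?_)
                                  (All.universal (λ y → sym (does-≤?-pred t y)) xs)))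

sum-map-pred : ∀ xs → sum (map pred xs) + count≥ 1 xs ≡ sum xs
sum-map-pred []           = refl
sum-map-pred (zero ∷ ys)  = sum-map-pred ys
sum-map-pred (suc y ∷ ys) = begin
  y + sum (map pred ys) + suc (count≥ 1 ys)   ≡⟨ +-suc (y + sum (map pred ys)) (count≥ 1 ys) ⟩
  suc (y + sum (map pred ys) + count≥ 1 ys)   ≡⟨ cong suc (+-assoc y (sum (map pred ys)) (count≥ 1 ys)) ⟩
  suc (y + (sum (map pred ys) + count≥ 1 ys)) ≡⟨ cong (λ s → suc (y + s)) (sum-map-pred ys) ⟩
  suc (y + sum ys)                            ∎
  where open ≡-Reasoning

count≥1≡0⇒part≡0 : ∀ ν → count≥ 1 ν ≡ 0 → ∀ i → part ν i ≡ 0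
count≥1≡0⇒part≡0 []           _ i             = refl
count≥1≡0⇒part≡0 (zero ∷ ys)  _ zero          = refl
count≥1≡0⇒part≡0 (zero ∷ ys)  _ (suc zero)    = refl
count≥1≡0⇒part≡0 (zero ∷ ys)  h (suc (suc i)) = count≥1≡0⇒part≡0 ys h (suc i)

count≥1≡0⇒sum≡0 : ∀ ν → count≥ 1 ν ≡ 0 → sum ν ≡ 0
count≥1≡0⇒sum≡0 []          _ = refl
count≥1≡0⇒sum≡0 (zero ∷ ys) h = count≥1≡0⇒sum≡0 ys h

count≥1-zero∷ : ∀ {xs} → Linked _≥_ (0 ∷ xs) → count≥ 1 (0 ∷ xs) ≡ 0
count≥1-zero∷ {[]}       _          = refl
count≥1-zero∷ {zero ∷ _} (z≤n ∷ ν↓) = count≥1-zero∷ ν↓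

length-filter-≢-upTo : ∀ n → length (filter (λ u → ¬? (u ≟ n)) (upTo (suc n))) ≡ n
length-filter-≢-upTo n = begin
  length (filter N? (upTo (suc n)))               ≡⟨ cong (length ∘ filter N?) (upTo-∷ʳ n) ⟨
  length (filter N? (upTo n ++ n ∷ []))           ≡⟨ cong length (filter-++ N? (upTo n) (n ∷ [])) ⟩
  length (filter N? (upTo n) ++ filter N? (n ∷ [])) ≡⟨ cong₂ (λ xs ys → length (xs ++ ys)) below-n at-n ⟩
  length (upTo n ++ [])                           ≡⟨ cong length (++-identityʳ (upTo n)) ⟩
  length (upTo n)                                 ≡⟨ length-upTo n ⟩
  n                                               ∎
  where
  open ≡-Reasoning
  N? = λ u → ¬? (u ≟ n)
  below-n : filter N? (upTo n) ≡ upTo n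
  below-n = filter-all N? (All.applyUpTo⁺₁ id n <⇒≢)
  at-n : filter N? (n ∷ []) ≡ []
  at-n = filter-reject N? (λ n≢n → n≢n refl)

-- The diagonal hooks of the 2-modular diagram of μ in terms of ν = toNu μ: hookCells μ i unfolds to
-- hook (toNu μ) i, and a cell is filled with 2 exactly when it does not end its row.
arm : List ℕ → ℕ → List (ℕ × ℕ)
arm ν i = map (i ,_) (range i (part ν i))

leg : List ℕ → ℕ → List (ℕ × ℕ)
leg ν i = map (_, i) (filter (λ r → i ≤? part ν r) (range (suc i) (length ν)))

hook : List ℕ → ℕ → List (ℕ × ℕ)
hook ν i = arm ν i ++ leg ν i

NotRowEnd : List ℕ → Pred (ℕ × ℕ) _
NotRowEnd ν (i , j) = j ≢ part ν i

notRowEnd? : ∀ ν → Decidable (NotRowEnd ν)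
notRowEnd? ν (i , j) = ¬? (j ≟ part ν i)

twos : List ℕ → ℕ → ℕ
twos ν i = length (filter (notRowEnd? ν) (hook ν i))

diag : List ℕ → List ℕ
diag ν = filter (λ i → i ≤? part ν i) (range 1 (length ν))

hookCounts : List ℕ → List ℕ
hookCounts ν = concatMap (λ i → length (hook ν i) ∷ twos ν i ∷ []) (diag ν)

does-fill≡2 : ∀ μ c → does (fill μ c ≟ 2) ≡ does (notRowEnd? (toNu μ) c)
does-fill≡2 μ (i , j) with j ≟ part (toNu μ) i
... | yes j≡νᵢ = sym (dec-false (notRowEnd? (toNu μ) (i , j)) (λ j≢νᵢ → j≢νᵢ j≡νᵢ))
... | no  j≢νᵢ = sym (dec-true (notRowEnd? (toNu μ) (i , j)) j≢νᵢ)

B≡hookCounts : ∀ μ → B μ ≡ filter (0 <?_) (hookCounts (toNu μ))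
B≡hookCounts μ = cong (filter (0 <?_)) (concatMap-cong hookTwos≡twos (diagonal μ))
  where
  hookTwos≡twos : ∀ i → hookSize μ i ∷ hookTwos μ i ∷ [] ≡ hookSize μ i ∷ twos (toNu μ) i ∷ []
  hookTwos≡twos i = cong (λ t → hookSize μ i ∷ t ∷ [])
    (cong length (filter-cong-local _ _ (All.universal (does-fill≡2 μ) (hookCells μ i))))

does-≟-pred : ∀ t y → does (2 + t ≟ y) ≡ does (suc t ≟ pred y)
does-≟-pred t zero    = refl
does-≟-pred t (suc y) = refl

does-≤?-part-peel : ∀ x xs i r →
  does (2 + i ≤? part (x ∷ xs) (2 + r)) ≡ does (suc i ≤? part (map pred xs) (suc r))
does-≤?-part-peel x xs i r =
  trans (does-≤?-pred i (part xs (suc r))) (cong (λ y → does (suc i ≤? y)) (sym (part-map-pred xs (suc r))))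

-- Deleting the first row and column of the diagram of x ∷ xs leaves that of map pred xs;
-- shift puts its cells back in place.
shift : ℕ × ℕ → ℕ × ℕ
shift = Product.map suc suc

arm-peel : ∀ x xs i → arm (x ∷ xs) (2 + i) ≡ map shift (arm (map pred xs) (suc i))
arm-peel x xs i = begin
  map (2 + i ,_) (range (2 + i) y)      ≡⟨ cong (map (2 + i ,_)) (range-pred i y) ⟩
  map (2 + i ,_) (map suc R)            ≡⟨ map-∘ R ⟨
  map (shift ∘ (suc i ,_)) R            ≡⟨ map-∘ R ⟩
  map shift (map (suc i ,_) R)          ≡⟨ cong (λ z → map shift (map (suc i ,_) (range (suc i) z)))
                                                (part-map-pred xs (suc i)) ⟨
  map shift (arm (map pred xs) (suc i)) ∎
  where
  open ≡-Reasoning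
  y = part xs (suc i)
  R = range (suc i) (pred y)

leg-peel : ∀ x xs i → leg (x ∷ xs) (2 + i) ≡ map shift (leg (map pred xs) (suc i))
leg-peel x xs i = begin
  map (_, 2 + i) (filter P? (range (3 + i) (suc L)))
    ≡⟨ cong (map (_, 2 + i) ∘ filter P?) (range-suc (2 + i) L) ⟩
  map (_, 2 + i) (filter P? (map suc R))
    ≡⟨ cong (map (_, 2 + i)) (filter-map P? suc R) ⟩
  map (_, 2 + i) (map suc (filter (P? ∘ suc) R))
    ≡⟨ cong (map (_, 2 + i) ∘ map suc) (filter-cong-local _ _ peeled) ⟩
  map (_, 2 + i) (map suc (filter Q? R))
    ≡⟨ map-∘ (filter Q? R) ⟨
  map (shift ∘ (_, suc i)) (filter Q? R)
    ≡⟨ map-∘ (filter Q? R) ⟩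
  map shift (map (_, suc i) (filter Q? R))
    ≡⟨ cong (λ z → map shift (map (_, suc i) (filter Q? (range (2 + i) z)))) (length-map pred xs) ⟨
  map shift (leg (map pred xs) (suc i))               ∎
  where
  open ≡-Reasoning
  L = length xs
  R = range (2 + i) L
  P? = λ r → 2 + i ≤? part (x ∷ xs) r
  Q? = λ r → suc i ≤? part (map pred xs) r
  peeled : All (λ r → does (P? (suc r)) ≡ does (Q? r)) R
  peeled = All-range (2 + i) L (λ u → does-≤?-part-peel x xs i (suc (i + u)))

hook-peel : ∀ x xs i → hook (x ∷ xs) (2 + i) ≡ map shift (hook (map pred xs) (suc i))
hook-peel x xs i = trans (cong₂ _++_ (arm-peel x xs i) (leg-peel x xs i))
                         (sym (map-++ shift (arm (map pred xs) (suc i)) (leg (map pred xs) (suc i))))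

hook-shifted : ∀ ν i → All (λ c → ∃ λ c′ → c ≡ shift c′) (hook ν (suc i))
hook-shifted ν i = All.++⁺
  (All.map⁺ (All-range (suc i) (part ν (suc i)) (λ u → (i , i + u) , refl)))
  (All.map⁺ (All.filter⁺ (λ r → suc i ≤? part ν r)
    (All-range (2 + i) (length ν) (λ u → (suc (i + u) , i) , refl))))

does-notRowEnd-peel : ∀ x xs c →
  does (notRowEnd? (x ∷ xs) (shift (shift c))) ≡ does (notRowEnd? (map pred xs) (shift c))
does-notRowEnd-peel x xs (a , b) =
  cong not (trans (does-≟-pred b (part xs (suc a)))
                            (cong (λ y → does (suc b ≟ y)) (sym (part-map-pred xs (suc a)))))

twos-peel : ∀ x xs i → twos (x ∷ xs) (2 + i) ≡ twos (map pred xs) (suc i)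
twos-peel x xs i = begin
  length (filter N? (hook (x ∷ xs) (2 + i)))
    ≡⟨ cong (length ∘ filter N?) (hook-peel x xs i) ⟩
  length (filter N? (map shift H))
    ≡⟨ length-filter-map N? shift H ⟩
  length (filter (N? ∘ shift) H)
    ≡⟨ cong length (filter-cong-local _ _ (All.map peeled (hook-shifted (map pred xs) i))) ⟩
  length (filter (notRowEnd? (map pred xs)) H) ∎
  where
  open ≡-Reasoning
  N? = notRowEnd? (x ∷ xs)
  H = hook (map pred xs) (suc i)
  peeled : ∀ {c} → ∃ (λ c′ → c ≡ shift c′) → does (N? (shift c)) ≡ does (notRowEnd? (map pred xs) c)
  peeled (c′ , refl) = does-notRowEnd-peel x xs c′

diag-peel : ∀ x xs → diag (suc x ∷ xs) ≡ 1 ∷ map suc (diag (map pred xs))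
diag-peel x xs = begin
  filter D? (range 1 (suc L))
    ≡⟨ cong (filter D?) (range-1-suc L) ⟩
  1 ∷ filter D? (map suc R)
    ≡⟨ cong (1 ∷_) (filter-map D? suc R) ⟩
  1 ∷ map suc (filter (D? ∘ suc) R)
    ≡⟨ cong (λ z → 1 ∷ map suc z) (filter-cong-local _ _ peeled) ⟩
  1 ∷ map suc (filter D*? R)
    ≡⟨ cong (λ z → 1 ∷ map suc (filter D*? (range 1 z))) (length-map pred xs) ⟨
  1 ∷ map suc (diag (map pred xs))         ∎
  where
  open ≡-Reasoning
  L = length xs
  R = range 1 L
  D? = λ i → i ≤? part (suc x ∷ xs) i
  D*? = λ i → i ≤? part (map pred xs) i
  peeled : All (λ i → does (D? (suc i)) ≡ does (D*? i)) R
  peeled = All-range 1 L (λ u → does-≤?-part-peel (suc x) xs u u)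

length-hook-first : ∀ x xs → length (hook (suc x ∷ xs) 1) ≡ suc x + count≥ 1 xs
length-hook-first x xs = begin
  length (arm ν 1 ++ leg ν 1)         ≡⟨ length-++ (arm ν 1) ⟩
  length (arm ν 1) + length (leg ν 1) ≡⟨ cong₂ _+_ arm-length leg-length ⟩
  suc x + count≥ 1 xs                 ∎
  where
  open ≡-Reasoning
  ν = suc x ∷ xs
  arm-length : length (arm ν 1) ≡ suc x
  arm-length = trans (length-map {B = ℕ × ℕ} (1 ,_) (range 1 (suc x)))
                     (trans (length-map suc (upTo (suc x))) (length-upTo (suc x)))
  leg-length : length (leg ν 1) ≡ count≥ 1 xs
  leg-length = trans (length-map {B = ℕ × ℕ} (_, 1) (filter (λ r → 1 ≤? part ν r) (range 2 (suc (length xs)))))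
                     (length-filter-part-tail (1 ≤?_) (suc x) xs)

does-≢1∧≥1 : ∀ y → does (¬? (1 ≟ y)) ∧ does (1 ≤? y) ≡ does (2 ≤? y)
does-≢1∧≥1 zero          = refl
does-≢1∧≥1 (suc zero)    = refl
does-≢1∧≥1 (suc (suc y)) = refl

twos-first : ∀ x xs → twos (suc x ∷ xs) 1 ≡ x + count≥ 2 xs
twos-first x xs = begin
  length (filter N? (arm ν 1 ++ leg ν 1))
    ≡⟨ cong length (filter-++ N? (arm ν 1) (leg ν 1)) ⟩
  length (filter N? (arm ν 1) ++ filter N? (leg ν 1))
    ≡⟨ length-++ (filter N? (arm ν 1)) ⟩
  length (filter N? (arm ν 1)) + length (filter N? (leg ν 1))
    ≡⟨ cong₂ _+_ arm-twos leg-twos ⟩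
  x + count≥ 2 xs                                              ∎
  where
  open ≡-Reasoning
  ν = suc x ∷ xs
  N? = notRowEnd? ν
  R = range 2 (suc (length xs))
  ≢1? = λ r → ¬? (1 ≟ part ν r)
  ≥1? = λ r → 1 ≤? part ν r
  ≥2? = λ r → 2 ≤? part ν r
  arm-twos : length (filter N? (arm ν 1)) ≡ x
  arm-twos = begin
    length (filter N? (map (1 ,_) (map suc U)))
      ≡⟨ length-filter-map N? (1 ,_) (map suc U) ⟩
    length (filter ≢1+x? (map suc U))
      ≡⟨ length-filter-map ≢1+x? suc U ⟩
    length (filter (≢1+x? ∘ suc) U)
      ≡⟨ cong length (filter-cong-local (≢1+x? ∘ suc) ≢x? (All.universal (λ _ → refl) U)) ⟩
    length (filter ≢x? U)
      ≡⟨ length-filter-≢-upTo x ⟩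
    x                                           ∎
    where
    U = upTo (suc x)
    ≢x? = λ u → ¬? (u ≟ x)
    ≢1+x? = λ j → ¬? (j ≟ suc x)
  leg-twos : length (filter N? (leg ν 1)) ≡ count≥ 2 xs
  leg-twos = begin
    length (filter N? (map (_, 1) (filter ≥1? R)))
      ≡⟨ length-filter-map N? (_, 1) (filter ≥1? R) ⟩
    length (filter ≢1? (filter ≥1? R))
      ≡⟨ cong length (filter-filter ≢1? ≥1? R) ⟩
    length (filter (≢1? ∩? ≥1?) R)
      ≡⟨ cong length (filter-cong-local (≢1? ∩? ≥1?) ≥2? (All.universal (does-≢1∧≥1 ∘ part ν) R)) ⟩
    length (filter ≥2? R)
      ≡⟨ length-filter-part-tail (2 ≤?_) (suc x) xs ⟩
    count≥ 2 xs                                    ∎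

hookCounts-peel : ∀ x xs →
  hookCounts (suc x ∷ xs) ≡ suc x + count≥ 1 xs ∷ x + count≥ 2 xs ∷ hookCounts (map pred xs)
hookCounts-peel x xs = begin
  concatMap G (diag ν)
    ≡⟨ cong (concatMap G) (diag-peel x xs) ⟩
  G 1 ++ concatMap G (map suc D*)
    ≡⟨ cong (G 1 ++_) (concatMap-map G suc D*) ⟩
  G 1 ++ concatMap (G ∘ suc) D*
    ≡⟨ cong (λ z → G 1 ++ concat z) (map-cong-local G-peel) ⟩
  G 1 ++ hookCounts ν*
    ≡⟨ cong₂ (λ a b → a ∷ b ∷ hookCounts ν*) (length-hook-first x xs) (twos-first x xs) ⟩
  suc x + count≥ 1 xs ∷ x + count≥ 2 xs ∷ hookCounts ν* ∎
  where
  open ≡-Reasoning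
  ν = suc x ∷ xs
  ν* = map pred xs
  D* = diag ν*
  G G* : ℕ → List ℕ
  G i = length (hook ν i) ∷ twos ν i ∷ []
  G* i = length (hook ν* i) ∷ twos ν* i ∷ []
  G-peel : All (λ i → G (suc i) ≡ G* i) D*
  G-peel = All.filter⁺ (λ i → i ≤? part ν* i) (All-range 1 (length ν*) (λ u →
    cong₂ (λ a b → a ∷ b ∷ [])
      (trans (cong length (hook-peel (suc x) xs u)) (length-map shift (hook ν* (suc u))))
      (twos-peel (suc x) xs u)))

count≥1≡0⇒hookCounts≡[] : ∀ ν → count≥ 1 ν ≡ 0 → hookCounts ν ≡ []
count≥1≡0⇒hookCounts≡[] ν h = cong (concatMap _) (filter-none (λ i → i ≤? part ν i)
  (All-range 1 (length ν) (λ u → subst (λ y → ¬ suc u ≤ y) (sym (count≥1≡0⇒part≡0 ν h (suc u))) λ ())))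

Linked-peel : ∀ {x xs} → Linked _≥_ (x ∷ xs) → Linked _≥_ (map pred xs)
Linked-peel [-]      = []
Linked-peel (_ ∷ ν↓) = Linked.map⁺ (Linked.map pred-mono-≤ ν↓)

peel-induction : ∀ {p} (P : List ℕ → Set p) →
  (∀ ν → count≥ 1 ν ≡ 0 → P ν) →
  (∀ x xs → P (map pred xs) → P (suc x ∷ xs)) →
  ∀ {ν} → Linked _≥_ ν → P ν
peel-induction P base step = go _ refl
  where
  go : ∀ n {ν} → length ν ≡ n → Linked _≥_ ν → P ν
  go _       {[]}         _   _  = base [] refl
  go _       {zero ∷ xs}  _   ν↓ = base (zero ∷ xs) (count≥1-zero∷ ν↓)
  go (suc n) {suc x ∷ xs} |ν| ν↓ =
    step x xs (go n (trans (length-map pred xs) (suc-injective |ν|)) (Linked-peel ν↓))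

sum-hookCounts : ∀ {ν} → Linked _≥_ ν → sum (hookCounts ν) + count≥ 1 ν ≡ 2 * sum ν
sum-hookCounts = peel-induction (λ ν → sum (hookCounts ν) + count≥ 1 ν ≡ 2 * sum ν) base step
  where
  base : ∀ ν → count≥ 1 ν ≡ 0 → sum (hookCounts ν) + count≥ 1 ν ≡ 2 * sum ν
  base ν h rewrite count≥1≡0⇒hookCounts≡[] ν h | h | count≥1≡0⇒sum≡0 ν h = refl
  step : ∀ x xs → sum (hookCounts (map pred xs)) + count≥ 1 (map pred xs) ≡ 2 * sum (map pred xs) →
         sum (hookCounts (suc x ∷ xs)) + count≥ 1 (suc x ∷ xs) ≡ 2 * sum (suc x ∷ xs)
  step x xs ih = begin
    sum (hookCounts (suc x ∷ xs)) + suc c₁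
      ≡⟨ cong (λ l → sum l + suc c₁) (hookCounts-peel x xs) ⟩
    suc x + c₁ + (x + c₂ + sum H) + suc c₁
      ≡⟨ regroup x c₁ c₂ (sum H) ⟩
    2 * (suc x + c₁) + (sum H + c₂)
      ≡⟨ cong (λ c → 2 * (suc x + c₁) + (sum H + c)) (count≥-pred 0 xs) ⟨
    2 * (suc x + c₁) + (sum H + count≥ 1 ν*)
      ≡⟨ cong (2 * (suc x + c₁) +_) ih ⟩
    2 * (suc x + c₁) + 2 * sum ν*
      ≡⟨ factor x c₁ (sum ν*) ⟩
    2 * (suc x + (sum ν* + c₁))
      ≡⟨ cong (λ s → 2 * (suc x + s)) (sum-map-pred xs) ⟩
    2 * (suc x + sum xs)                        ∎
    where
    open ≡-Reasoning
    ν* = map pred xs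
    H = hookCounts ν*
    c₁ = count≥ 1 xs
    c₂ = count≥ 2 xs
    regroup : ∀ x a b s → suc x + a + (x + b + s) + suc a ≡ 2 * (suc x + a) + (s + b)
    regroup = solve-∀
    factor : ∀ x a s → 2 * (suc x + a) + 2 * s ≡ 2 * (suc x + (s + a))
    factor = solve-∀

sum-filter-pos : ∀ xs → sum (filter (0 <?_) xs) ≡ sum xs
sum-filter-pos []           = refl
sum-filter-pos (zero ∷ xs)  = sum-filter-pos xs
sum-filter-pos (suc x ∷ xs) = cong (suc x +_) (sum-filter-pos xs)

-- B discards zeros; in hookCounts only the number of 2s in the last diagonal hook can be zero,
-- so discarding it leaves the odd positions in place.
oddIndexedSum-filter-pos : ∀ a t xs → (t ≡ 0 → xs ≡ []) →
  oddIndexedSum (filter (0 <?_) (suc a ∷ t ∷ xs)) ≡ suc a + oddIndexedSum (filter (0 <?_) xs)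
oddIndexedSum-filter-pos a zero    xs last rewrite last refl = sym (+-identityʳ (suc a))
oddIndexedSum-filter-pos a (suc t) xs _ = refl

oddIndexedSum-hookCounts : ∀ {ν} → Linked _≥_ ν → oddIndexedSum (filter (0 <?_) (hookCounts ν)) ≡ sum ν
oddIndexedSum-hookCounts = peel-induction (λ ν → oddIndexedSum (filter (0 <?_) (hookCounts ν)) ≡ sum ν) base step
  where
  base : ∀ ν → count≥ 1 ν ≡ 0 → oddIndexedSum (filter (0 <?_) (hookCounts ν)) ≡ sum ν
  base ν h rewrite count≥1≡0⇒hookCounts≡[] ν h | count≥1≡0⇒sum≡0 ν h = refl
  step : ∀ x xs → oddIndexedSum (filter (0 <?_) (hookCounts (map pred xs))) ≡ sum (map pred xs) →
         oddIndexedSum (filter (0 <?_) (hookCounts (suc x ∷ xs))) ≡ sum (suc x ∷ xs)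
  step x xs ih = begin
    oddIndexedSum (filter (0 <?_) (hookCounts (suc x ∷ xs)))
      ≡⟨ cong (oddIndexedSum ∘ filter (0 <?_)) (hookCounts-peel x xs) ⟩
    oddIndexedSum (filter (0 <?_) (suc x + c₁ ∷ x + c₂ ∷ H))
      ≡⟨ oddIndexedSum-filter-pos (x + c₁) (x + c₂) H last ⟩
    suc x + c₁ + oddIndexedSum (filter (0 <?_) H)
      ≡⟨ cong (suc x + c₁ +_) ih ⟩
    suc x + c₁ + sum ν*
      ≡⟨ +-assoc (suc x) c₁ (sum ν*) ⟩
    suc x + (c₁ + sum ν*)
      ≡⟨ cong (suc x +_) (trans (+-comm c₁ (sum ν*)) (sum-map-pred xs)) ⟩
    suc x + sum xs                                                    ∎
    where
    open ≡-Reasoning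
    ν* = map pred xs
    H = hookCounts ν*
    c₁ = count≥ 1 xs
    c₂ = count≥ 2 xs
    last : x + c₂ ≡ 0 → H ≡ []
    last x+c₂≡0 = count≥1≡0⇒hookCounts≡[] ν* (trans (count≥-pred 0 xs) (m+n≡0⇒n≡0 x x+c₂≡0))

⌊2*n/2⌋≡n : ∀ n → ⌊ 2 * n /2⌋ ≡ n
⌊2*n/2⌋≡n n = trans (cong (λ m → ⌊ n + m /2⌋) (+-identityʳ n)) (sym (n≡⌊n+n/2⌋ n))

Linked-toNu : ∀ {μ} → Linked _≥_ μ → Linked _≥_ (toNu μ)
Linked-toNu = Linked.map⁺ ∘ Linked.map (⌊n/2⌋-mono ∘ s≤s)

count≥1-toNu : ∀ {μ} → All Odd μ → count≥ 1 (toNu μ) ≡ length μ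
count≥1-toNu []               = refl
count≥1-toNu ((j , refl) ∷ odd) = cong suc (count≥1-toNu odd)

sum-toNu : ∀ {μ} → All Odd μ → 2 * sum (toNu μ) ≡ sum μ + length μ
sum-toNu []                           = refl
sum-toNu {μ = _ ∷ μs} ((j , refl) ∷ odd) = begin
  2 * (suc ⌊ 2 * j /2⌋ + sum (toNu μs))   ≡⟨ cong (λ h → 2 * (suc h + sum (toNu μs))) (⌊2*n/2⌋≡n j) ⟩
  2 * (suc j + sum (toNu μs))             ≡⟨ *-distribˡ-+ 2 (suc j) (sum (toNu μs)) ⟩
  2 * suc j + 2 * sum (toNu μs)           ≡⟨ cong (2 * suc j +_) (sum-toNu odd) ⟩
  2 * suc j + (sum μs + length μs)        ≡⟨ regroup j (sum μs) (length μs) ⟩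
  suc (2 * j) + sum μs + suc (length μs)  ∎
  where
  open ≡-Reasoning
  regroup : ∀ j s l → 2 * suc j + (s + l) ≡ suc (2 * j) + s + suc l
  regroup = solve-∀

size-B : ∀ {μ} → IsOddPartition μ → size (B μ) ≡ size μ
size-B {μ} ((μ↓ , _) , odd) = +-cancelʳ-≡ (length μ) (size (B μ)) (size μ) (begin
  size (B μ) + length μ
    ≡⟨ cong (λ l → sum l + length μ) (B≡hookCounts μ) ⟩
  sum (filter (0 <?_) (hookCounts ν)) + length μ
    ≡⟨ cong₂ _+_ (sum-filter-pos (hookCounts ν)) (sym (count≥1-toNu odd)) ⟩
  sum (hookCounts ν) + count≥ 1 ν
    ≡⟨ sum-hookCounts (Linked-toNu μ↓) ⟩
  2 * sum ν
    ≡⟨ sum-toNu odd ⟩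
  size μ + length μ                              ∎)
  where
  open ≡-Reasoning
  ν = toNu μ

oddIndexedSum-B : ∀ {μ} → IsOddPartition μ → 2 * oddIndexedSum (B μ) ≡ size μ + length μ
oddIndexedSum-B {μ} ((μ↓ , _) , odd) = begin
  2 * oddIndexedSum (B μ)
    ≡⟨ cong (λ l → 2 * oddIndexedSum l) (B≡hookCounts μ) ⟩
  2 * oddIndexedSum (filter (0 <?_) (hookCounts (toNu μ)))
    ≡⟨ cong (2 *_) (oddIndexedSum-hookCounts (Linked-toNu μ↓)) ⟩
  2 * sum (toNu μ)
    ≡⟨ sum-toNu odd ⟩
  size μ + length μ                                        ∎
  where open ≡-Reasoning

first-part-B : ∀ {μ₁ μs} → All Odd (μ₁ ∷ μs) → 1 + 2 * part (B (μ₁ ∷ μs)) 1 ≡ μ₁ + 2 * length (μ₁ ∷ μs)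
first-part-B {μs = μs} odd@((j , refl) ∷ odds) = begin
  1 + 2 * part (B μ) 1
    ≡⟨ cong (λ l → 1 + 2 * part l 1) (B≡hookCounts μ) ⟩
  1 + 2 * part (filter (0 <?_) (hookCounts (suc h ∷ toNu μs))) 1
    ≡⟨ cong (λ l → 1 + 2 * part (filter (0 <?_) l) 1) (hookCounts-peel h (toNu μs)) ⟩
  1 + 2 * (suc h + count≥ 1 (toNu μs))
    ≡⟨ cong₂ (λ a b → 1 + 2 * (suc a + b)) (⌊2*n/2⌋≡n j) (count≥1-toNu odds) ⟩
  1 + 2 * (suc j + length μs)
    ≡⟨ regroup j (length μs) ⟩
  suc (2 * j) + 2 * suc (length μs)                               ∎
  where
  open ≡-Reasoning
  μ = suc (2 * j) ∷ μs
  h = ⌊ 2 * j /2⌋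
  regroup : ∀ j l → 1 + 2 * (suc j + l) ≡ suc (2 * j) + 2 * suc l
  regroup = solve-∀

+m≡+o-+n : ∀ {m n o} → m + n ≡ o → ℤ.+ m ≡ ℤ.+ o ℤ.- ℤ.+ n
+m≡+o-+n {m} {n} refl = sym (begin
  ℤ.+ (m + n) ℤ.- ℤ.+ n ≡⟨ ℤ.m-n≡m⊖n (m + n) n ⟩
  (m + n) ℤ.⊖ n         ≡⟨ ℤ.⊖-≥ (m≤n+m n m) ⟩
  ℤ.+ (m + n ∸ n)       ≡⟨ cong ℤ.+_ (m+n∸n≡m m n) ⟩
  ℤ.+ m                 ∎)
  where open ≡-Reasoning

proposition1 : (n m k : ℕ) (lam mu : List ℕ) →
    IsDistinctPartition lam → size lam ≡ n → 1 ≤ n →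
    part lam 1 ≡ k → oddIndexedSum lam ≡ m →
    IsOddPartition mu → B mu ≡ lam →
    (ℤ.+ length mu ≡ ℤ.+ (2 * m) ℤ.- ℤ.+ n) × (ℤ.+ part mu 1 ≡ ℤ.+ 1 ℤ.+ ℤ.+ (2 * k) ℤ.+ ℤ.+ (2 * n) ℤ.- ℤ.+ (4 * m))
proposition1 _ _ _ _ []            _ refl () _    _    _     refl  -- B [] = [] has size 0
proposition1 _ _ _ _ mu@(μ₁ ∷ μs) _ refl _  refl refl μ-odd refl =
  +m≡+o-+n ℓ+n≡2m , +m≡+o-+n μ₁+4m≡1+2k+2n
  where
  open ≡-Reasoning
  ℓ = length mu
  n = size (B mu)
  m = oddIndexedSum (B mu)
  k = part (B mu) 1
  ℓ+n≡2m : ℓ + n ≡ 2 * m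
  ℓ+n≡2m = trans (+-comm ℓ n) (trans (cong (_+ ℓ) (size-B μ-odd)) (sym (oddIndexedSum-B μ-odd)))
  μ₁+4m≡1+2k+2n : μ₁ + 4 * m ≡ 1 + 2 * k + 2 * n
  μ₁+4m≡1+2k+2n = begin
    μ₁ + 4 * m                ≡⟨ cong (μ₁ +_) (*-assoc 2 2 m) ⟩
    μ₁ + 2 * (2 * m)          ≡⟨ cong (λ x → μ₁ + 2 * x) (oddIndexedSum-B μ-odd) ⟩
    μ₁ + 2 * (size mu + ℓ)    ≡⟨ regroup μ₁ (size mu) ℓ ⟩
    μ₁ + 2 * ℓ + 2 * size mu  ≡⟨ cong₂ (λ a b → a + 2 * b) (first-part-B (proj₂ μ-odd)) (size-B μ-odd) ⟨
    1 + 2 * k + 2 * n         ∎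
    where
    regroup : ∀ a s l → a + 2 * (s + l) ≡ a + 2 * l + 2 * s
    regroup = solve-∀
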